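{- Let $n$, $m$ and $t$ be positive integers with $n>t>1$ and $m\le \left\lfloor \frac{n}{t+1}\right\rfloor$. Then $$p^{(t)}(n,m)=p^{(t-1)}(n,m)-p^{(t-1)}(n-t,m).$$
   Context: A partition of a positive integer $n$ is a finite sequence $\lambda=[\lambda_1,\ldots,\lambda_k]$ of positive integers with $\lambda_1\ge\cdots\ge\lambda_k$ and $\lambda_1+\cdots+\lambda_k=n$; we write $\lambda\vdash n$. For positive integers $n,m,t$, $p^{(t)}(n,m)$ denotes the number of partitions $\lambda\vdash n$ all of whose parts are at least $m$ and which satisfy $\lambda_1\ge t\cdot\lambda_2$. The one-part partition $[n]$ is considered to satisfy this condition, so it is counted whenever $n\ge m$. In particular, $p^{(t)}(n,m)=0$ if $n<m$, and $p^{(1)}(n,m)$ is the number of partitions of $n$ with all parts at least $m$. -}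

module Defs where

open import Data.Nat using (ℕ; zero; suc; _+_; _*_; _≤_; _≤?_; _≟_)
open import Data.Nat.ListAction using (sum)
open import Data.List using (List; []; _∷_; length; filter; map; concatMap; upTo)
open import Data.List.Relation.Unary.Linked using (Linked)
import Data.List.Relation.Unary.Linked as Linked
open import Data.List.Relation.Unary.All using (All)
import Data.List.Relation.Unary.All as All
open import Data.Product using (_×_)
open import Data.Unit using (⊤; tt)
open import Relation.Nullary using (Dec; yes; no)
open import Relation.Nullary.Decidable using (_×-dec_)
open import Relation.Binary.PropositionalEquality using (_≡_)

IsPartition : ℕ → List ℕ → Set
IsPartition n λs = (Linked (λ a b → b ≤ a) λs × All (λ a → 1 ≤ a) λs) × sum λs ≡ n

PartsAtLeast : ℕ → List ℕ → Set
PartsAtLeast m λs = All (λ a → m ≤ a) λs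

-- λ₁ ≥ t · λ₂ ; the one-part partition [n] (and []) satisfy it vacuously.
Cond : ℕ → List ℕ → Set
Cond t (a ∷ b ∷ _) = t * b ≤ a
Cond t _ = ⊤

Counted : ℕ → ℕ → ℕ → List ℕ → Set
Counted t n m λs = (IsPartition n λs × PartsAtLeast m λs) × Cond t λs

cond? : (t : ℕ) (λs : List ℕ) → Dec (Cond t λs)
cond? t (a ∷ b ∷ _) = t * b ≤? a
cond? t [] = yes tt
cond? t (_ ∷ []) = yes tt

counted? : (t n m : ℕ) (λs : List ℕ) → Dec (Counted t n m λs)
counted? t n m λs =
  ((((Linked.linked? (λ a b → b ≤? a) λs) ×-dec (All.all? (λ a → 1 ≤? a) λs))
     ×-dec (sum λs ≟ n))
   ×-dec (All.all? (λ a → m ≤? a) λs))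
  ×-dec cond? t λs

-- A finite search space: all lists of length ≤ k with entries in {1, …, n}.
-- (Every partition of n has at most n parts, each between 1 and n, so every
--  partition of n occurs in candidates n n, exactly once.)
candidates : ℕ → ℕ → List (List ℕ)
candidates n zero = [] ∷ []
candidates n (suc k) =
  [] ∷ concatMap (λ a → map (a ∷_) (candidates n k)) (map suc (upTo n))

p : ℕ → ℕ → ℕ → ℕ
p t n m = length (filter (counted? t n m) (candidates n n))

module Submission where

-- Fix the second part b of a partition λ = a ∷ b ∷ ν ⊢ N with all parts
-- ≥ m.  Then λ₁ = a ≥ t·b  iff  sum ν ≤ N − (t+1)·b, so
--     p⁽ᵗ⁾(N,m) = [m ≤ N] + Σ_b [m ≤ b, (t+1)·b ≤ N] · tails b (N − (t+1)·b),
-- where  tails b Z  counts partitions with parts in [m,b] of total ≤ Z.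
-- Splitting these tails according to whether a part equal to b occurs
-- ( tails (b+1) Z = tails b Z + [m ≤ b+1 ≤ Z] · tails (b+1) (Z − (b+1)) )
-- turns the b+1 summand for t−1 into the b+1 summand for t, plus the
-- b summand for t−1 and size n − t, plus one extra term at b+1 = m.
-- Summing over b gives  p⁽ᵗ⁻¹⁾(n) = p⁽ᵗ⁾(n) + p⁽ᵗ⁻¹⁾(n − t), whence the theorem.

open import Defs
open import Data.Nat using (ℕ; zero; suc; _+_; _*_; _∸_; _≤_; _<_; _/_; _≤?_; _≟_; z≤n; s≤s; NonZero)
open import Data.Nat.Properties
open import Data.Nat.ListAction using (sum)
open import Data.Nat.DivMod using (m/n*n≤m)
open import Data.Nat.Solver using (module +-*-Solver)
open import Data.List using (List; []; _∷_; _++_; length; filter; map; concatMap; upTo)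
open import Data.List.Properties using (map-++; upTo-∷ʳ)
open import Data.List.Relation.Unary.Linked using (Linked; [-]; _∷_)
import Data.List.Relation.Unary.Linked as Linked
open import Data.List.Relation.Unary.All using (All; []; _∷_)
import Data.List.Relation.Unary.All as All
open import Data.Product using (_×_; _,_; proj₁; proj₂)
open import Data.Sum using (inj₁; inj₂)
open import Data.Unit using (tt)
open import Data.Empty using (⊥-elim)
open import Function using (_∘_)
open import Relation.Nullary using (Dec; yes; no; ¬_)
open import Relation.Nullary.Decidable using (_×-dec_)
open import Relation.Binary.PropositionalEquality
open import Algebra.Properties.CommutativeSemigroup +-commutativeSemigroup using (interchange)

when : {P : Set} → Dec P → ℕ → ℕ
when (yes _) x = x
when (no _)  _ = 0

when-yes : {P : Set} (d : Dec P) {x : ℕ} → P → when d x ≡ x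
when-yes (yes _) _  = refl
when-yes (no ¬p) p = ⊥-elim (¬p p)

when-no : {P : Set} (d : Dec P) {x : ℕ} → ¬ P → when d x ≡ 0
when-no (yes p) ¬p = ⊥-elim (¬p p)
when-no (no _)  _  = refl

when-0 : {P : Set} (d : Dec P) → when d 0 ≡ 0
when-0 (yes _) = refl
when-0 (no _)  = refl

when-cong : {P : Set} (d : Dec P) {x y : ℕ} → (P → x ≡ y) → when d x ≡ when d y
when-cong (yes p) x≡y = x≡y p
when-cong (no _)  _   = refl

when-⇔ : {P Q : Set} (d : Dec P) (e : Dec Q) {x y : ℕ} →
  (P → Q) → (Q → P) → (P → x ≡ y) → when d x ≡ when e y
when-⇔ (yes p) (yes _) _ _ x≡y = x≡y p
when-⇔ (yes p) (no ¬q) f _ _ = ⊥-elim (¬q (f p))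
when-⇔ (no ¬p) (yes q) _ g _ = ⊥-elim (¬p (g q))
when-⇔ (no _)  (no _)  _ _ _ = refl

when-× : {P Q U : Set} (d : Dec P) (e : Dec Q) (u : Dec U) {x : ℕ} →
  (U → P × Q) → (P × Q → U) → when u x ≡ when d (when e x)
when-× (yes p) (yes q) u _ g = when-yes u (g (p , q))
when-× (yes _) (no ¬q) u f _ = when-no u (λ z → ¬q (proj₂ (f z)))
when-× (no ¬p) e       u f _ = when-no u (λ z → ¬p (proj₁ (f z)))

total : {A : Set} → (A → ℕ) → List A → ℕ
total f []       = 0
total f (x ∷ xs) = f x + total f xs

total-++ : {A : Set} (f : A → ℕ) (xs ys : List A) → total f (xs ++ ys) ≡ total f xs + total f ys
total-++ f []       ys = refl
total-++ f (x ∷ xs) ys = trans (cong (f x +_) (total-++ f xs ys)) (sym (+-assoc (f x) _ _))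

total-map : {A B : Set} (f : B → ℕ) (g : A → B) (xs : List A) →
  total f (map g xs) ≡ total (λ x → f (g x)) xs
total-map f g []       = refl
total-map f g (x ∷ xs) = cong (f (g x) +_) (total-map f g xs)

total-concatMap : {A B : Set} (f : B → ℕ) (h : A → List B) (xs : List A) →
  total f (concatMap h xs) ≡ total (λ x → total f (h x)) xs
total-concatMap f h []       = refl
total-concatMap f h (x ∷ xs) =
  trans (total-++ f (h x) (concatMap h xs)) (cong (total f (h x) +_) (total-concatMap f h xs))

total-cong : {A : Set} {f g : A → ℕ} → (∀ x → f x ≡ g x) → (xs : List A) → total f xs ≡ total g xs
total-cong f≡g []       = refl
total-cong f≡g (x ∷ xs) = cong₂ _+_ (f≡g x) (total-cong f≡g xs)

total-+ : {A : Set} (f g : A → ℕ) (xs : List A) →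
  total (λ x → f x + g x) xs ≡ total f xs + total g xs
total-+ f g []       = refl
total-+ f g (x ∷ xs) =
  trans (cong (f x + g x +_) (total-+ f g xs)) (interchange (f x) (g x) (total f xs) (total g xs))

total-when : {A P : Set} (d : Dec P) (f : A → ℕ) (xs : List A) →
  total (λ x → when d (f x)) xs ≡ when d (total f xs)
total-when (yes _) f xs       = refl
total-when (no _)  f []       = refl
total-when (no ¬p) f (x ∷ xs) = total-when (no ¬p) f xs

count-filter : {A : Set} {P : A → Set} (P? : ∀ x → Dec (P x)) (xs : List A) →
  length (filter P? xs) ≡ total (λ x → when (P? x) 1) xs
count-filter P? []       = refl
count-filter P? (x ∷ xs) with P? x
... | yes _ = cong suc (count-filter P? xs)
... | no _  = count-filter P? xs

∑ : ℕ → (ℕ → ℕ) → ℕ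
∑ zero    h = 0
∑ (suc N) h = ∑ N h + h (suc N)

∑-cong : ∀ N {h g : ℕ → ℕ} → (∀ a → 1 ≤ a → a ≤ N → h a ≡ g a) → ∑ N h ≡ ∑ N g
∑-cong zero    h≡g = refl
∑-cong (suc N) h≡g =
  cong₂ _+_ (∑-cong N (λ a 1≤a a≤N → h≡g a 1≤a (m≤n⇒m≤1+n a≤N))) (h≡g (suc N) (s≤s z≤n) ≤-refl)

∑-+ : ∀ N (h g : ℕ → ℕ) → ∑ N (λ a → h a + g a) ≡ ∑ N h + ∑ N g
∑-+ zero    h g = refl
∑-+ (suc N) h g =
  trans (cong (_+ (h (suc N) + g (suc N))) (∑-+ N h g)) (interchange (∑ N h) (∑ N g) _ _)

∑-zero : ∀ N {h : ℕ → ℕ} → (∀ a → 1 ≤ a → a ≤ N → h a ≡ 0) → ∑ N h ≡ 0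
∑-zero zero    _  = refl
∑-zero (suc N) h≡0 =
  cong₂ _+_ (∑-zero N (λ a 1≤a a≤N → h≡0 a 1≤a (m≤n⇒m≤1+n a≤N))) (h≡0 (suc N) (s≤s z≤n) ≤-refl)

∑-truncate : ∀ b N {h : ℕ → ℕ} → (∀ a → b < a → h a ≡ 0) → b ≤ N → ∑ N h ≡ ∑ b h
∑-truncate b zero    _   z≤n = refl
∑-truncate b (suc N) h≡0 b≤1+N with m≤n⇒m<n∨m≡n b≤1+N
... | inj₁ (s≤s b≤N) = trans (cong₂ _+_ (∑-truncate b N h≡0 b≤N) (h≡0 (suc N) (s≤s b≤N))) (+-identityʳ _)
... | inj₂ refl      = refl

∑-delta : ∀ N v x → 1 ≤ v → v ≤ N → ∑ N (λ a → when (a ≟ v) x) ≡ x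
∑-delta N (suc v) x _ v≤N = begin
  ∑ N δ              ≡⟨ ∑-truncate (suc v) N (λ a v<a → when-no (a ≟ suc v) (>⇒≢ v<a)) v≤N ⟩
  ∑ v δ + δ (suc v)  ≡⟨ cong₂ _+_ (∑-zero v (λ a _ a≤v → when-no (a ≟ suc v) (<⇒≢ (s≤s a≤v))))
                                  (when-yes (suc v ≟ suc v) refl) ⟩
  x                  ∎
  where
  open ≡-Reasoning
  δ : ℕ → ℕ
  δ a = when (a ≟ suc v) x

∑-delta-when : ∀ N v x {P : Set} (d : Dec P) → (P → 1 ≤ v) → v ≤ N →
  ∑ N (λ a → when (a ≟ v) (when d x)) ≡ when d x
∑-delta-when N v x (yes p) 1≤v v≤N = ∑-delta N v x (1≤v p) v≤N
∑-delta-when N v x (no _)  _   _   = ∑-zero N (λ a _ _ → when-0 (a ≟ v))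

∑-shift : ∀ N {h : ℕ → ℕ} → h 0 ≡ 0 → ∑ N (λ a → h (a ∸ 1)) ≡ ∑ (N ∸ 1) h
∑-shift zero             _    = refl
∑-shift (suc zero)       h0≡0 = h0≡0
∑-shift (suc (suc N)) {h} h0≡0 = cong (_+ h (suc N)) (∑-shift (suc N) h0≡0)

total-range : (h : ℕ → ℕ) (N : ℕ) → total h (map suc (upTo N)) ≡ ∑ N h
total-range h zero    = refl
total-range h (suc N) = begin
  total h (map suc (upTo (suc N)))           ≡⟨ cong (total h ∘ map suc) (sym (upTo-∷ʳ N)) ⟩
  total h (map suc (upTo N ++ N ∷ []))       ≡⟨ cong (total h) (map-++ suc (upTo N) (N ∷ [])) ⟩
  total h (map suc (upTo N) ++ suc N ∷ [])   ≡⟨ total-++ h (map suc (upTo N)) (suc N ∷ []) ⟩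
  total h (map suc (upTo N)) + (h (suc N) + 0) ≡⟨ cong₂ _+_ (total-range h N) (+-identityʳ _) ⟩
  ∑ (suc N) h                                ∎
  where open ≡-Reasoning

total-∑ : {A : Set} (M : ℕ) (k : ℕ → A → ℕ) (xs : List A) →
  total (λ x → ∑ M (λ a → k a x)) xs ≡ ∑ M (λ a → total (k a) xs)
total-∑ zero    k []       = refl
total-∑ zero    k (x ∷ xs) = total-∑ zero k xs
total-∑ (suc M) k xs =
  trans (total-+ _ (k (suc M)) xs) (cong (_+ total (k (suc M)) xs) (total-∑ M k xs))

candSum : ℕ → ℕ → (List ℕ → ℕ) → ℕ
candSum N K f = total f (candidates N K)

candSum-zero : (N : ℕ) (f : List ℕ → ℕ) → candSum N 0 f ≡ f []
candSum-zero N f = +-identityʳ (f [])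

candSum-suc : (N K : ℕ) (f : List ℕ → ℕ) →
  candSum N (suc K) f ≡ f [] + ∑ N (λ a → candSum N K (λ r → f (a ∷ r)))
candSum-suc N K f = cong (f [] +_) (begin
  total f (concatMap (λ a → map (a ∷_) (candidates N K)) (map suc (upTo N)))
    ≡⟨ total-concatMap f _ (map suc (upTo N)) ⟩
  total (λ a → total f (map (a ∷_) (candidates N K))) (map suc (upTo N))
    ≡⟨ total-cong (λ a → total-map f (a ∷_) (candidates N K)) (map suc (upTo N)) ⟩
  total (λ a → candSum N K (λ r → f (a ∷ r))) (map suc (upTo N))
    ≡⟨ total-range _ N ⟩
  ∑ N (λ a → candSum N K (λ r → f (a ∷ r))) ∎)
  where open ≡-Reasoning

-- Counting the possible tails ν of a partition, i.e. the parts following a given part.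
module Tails (m : ℕ) where

  TailBelow : ℕ → ℕ → List ℕ → Set
  TailBelow b Z ν = (Linked (λ x y → y ≤ x) (b ∷ ν) × All (λ x → m ≤ x) ν) × sum ν ≤ Z

  tailBelow? : (b Z : ℕ) (ν : List ℕ) → Dec (TailBelow b Z ν)
  tailBelow? b Z ν =
    (Linked.linked? (λ x y → y ≤? x) (b ∷ ν) ×-dec All.all? (λ x → m ≤? x) ν) ×-dec (sum ν ≤? Z)

  tailBelow-[] : (b Z : ℕ) → TailBelow b Z []
  tailBelow-[] b Z = ([-] , []) , z≤n

  NextPart : ℕ → ℕ → ℕ → Set
  NextPart b Z c = (m ≤ c × c ≤ b) × c ≤ Z

  nextPart? : (b Z c : ℕ) → Dec (NextPart b Z c)
  nextPart? b Z c = ((m ≤? c) ×-dec (c ≤? b)) ×-dec (c ≤? Z)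

  tailBelow-∷ : (b Z c : ℕ) (ν : List ℕ) →
    when (tailBelow? b Z (c ∷ ν)) 1 ≡ when (nextPart? b Z c) (when (tailBelow? c (Z ∸ c) ν) 1)
  tailBelow-∷ b Z c ν = when-× (nextPart? b Z c) (tailBelow? c (Z ∸ c) ν) (tailBelow? b Z (c ∷ ν)) split join
    where
    split : TailBelow b Z (c ∷ ν) → NextPart b Z c × TailBelow c (Z ∸ c) ν
    split ((c≤b ∷ ordered , m≤c ∷ large) , c+ν≤Z) =
      ((m≤c , c≤b) , m+n≤o⇒m≤o c c+ν≤Z) ,
      ((ordered , large) , m+n≤o⇒m≤o∸n (sum ν) (subst (_≤ Z) (+-comm c (sum ν)) c+ν≤Z))
    join : NextPart b Z c × TailBelow c (Z ∸ c) ν → TailBelow b Z (c ∷ ν)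
    join (((m≤c , c≤b) , c≤Z) , ((ordered , large) , ν≤Z∸c)) =
      ((c≤b ∷ ordered) , (m≤c ∷ large)) ,
      subst (_≤ Z) (+-comm (sum ν) c) (m≤o∸n⇒m+n≤o (sum ν) c≤Z ν≤Z∸c)

  tailsUpTo : ℕ → ℕ → ℕ → ℕ
  tailsUpTo zero    b Z = 1
  tailsUpTo (suc k) b Z = 1 + ∑ b (λ c → when (nextPart? b Z c) (tailsUpTo k c (Z ∸ c)))

  count-tails : ∀ K N b Z → b ≤ N → candSum N K (λ ν → when (tailBelow? b Z ν) 1) ≡ tailsUpTo K b Z
  count-tails zero N b Z _ =
    trans (candSum-zero N (λ ν → when (tailBelow? b Z ν) 1)) (when-yes (tailBelow? b Z []) (tailBelow-[] b Z))
  count-tails (suc K) N b Z b≤N = begin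
    candSum N (suc K) (λ ν → when (tailBelow? b Z ν) 1)
      ≡⟨ candSum-suc N K (λ ν → when (tailBelow? b Z ν) 1) ⟩
    when (tailBelow? b Z []) 1 + ∑ N (λ c → candSum N K (λ ν → when (tailBelow? b Z (c ∷ ν)) 1))
      ≡⟨ cong₂ _+_ (when-yes (tailBelow? b Z []) (tailBelow-[] b Z)) (∑-cong N next) ⟩
    1 + ∑ N (λ c → when (nextPart? b Z c) (tailsUpTo K c (Z ∸ c)))
      ≡⟨ cong (1 +_) (∑-truncate b N
           (λ c b<c → when-no (nextPart? b Z c) (<⇒≱ b<c ∘ proj₂ ∘ proj₁)) b≤N) ⟩
    tailsUpTo (suc K) b Z ∎
    where
    open ≡-Reasoning
    next : ∀ c → 1 ≤ c → c ≤ N →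
      candSum N K (λ ν → when (tailBelow? b Z (c ∷ ν)) 1) ≡ when (nextPart? b Z c) (tailsUpTo K c (Z ∸ c))
    next c _ _ = begin
      candSum N K (λ ν → when (tailBelow? b Z (c ∷ ν)) 1)
        ≡⟨ total-cong (tailBelow-∷ b Z c) (candidates N K) ⟩
      candSum N K (λ ν → when (nextPart? b Z c) (when (tailBelow? c (Z ∸ c) ν) 1))
        ≡⟨ total-when (nextPart? b Z c) _ (candidates N K) ⟩
      when (nextPart? b Z c) (candSum N K (λ ν → when (tailBelow? c (Z ∸ c) ν) 1))
        ≡⟨ when-cong (nextPart? b Z c)
             (λ next → count-tails K N c (Z ∸ c) (≤-trans (proj₂ (proj₁ next)) b≤N)) ⟩
      when (nextPart? b Z c) (tailsUpTo K c (Z ∸ c)) ∎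

  tailsUpTo-broke : ∀ k b → tailsUpTo k b 0 ≡ 1
  tailsUpTo-broke zero    b = refl
  tailsUpTo-broke (suc k) b =
    cong (1 +_) (∑-zero b (λ c 1≤c _ → when-no (nextPart? b 0 c) (<⇒≱ 1≤c ∘ proj₂)))

  -- Parts are ≥ 1, so a tail within budget Z has at most Z parts: any bound k ≥ Z gives the same count.
  tailsUpTo-stable : ∀ k k' b Z → Z ≤ k → Z ≤ k' → tailsUpTo k b Z ≡ tailsUpTo k' b Z
  tailsUpTo-stable zero    k'       b .0 z≤n _   = sym (tailsUpTo-broke k' b)
  tailsUpTo-stable (suc k) zero     b .0 _   z≤n = tailsUpTo-broke (suc k) b
  tailsUpTo-stable (suc k) (suc k') b Z  Z≤k Z≤k' =
    cong (1 +_) (∑-cong b (λ c 1≤c _ → when-cong (nextPart? b Z c) (λ _ →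
      tailsUpTo-stable k k' c (Z ∸ c) (budget-drop 1≤c Z≤k) (budget-drop 1≤c Z≤k'))))
    where
    budget-drop : ∀ {c j} → 1 ≤ c → Z ≤ suc j → Z ∸ c ≤ j
    budget-drop 1≤c Z≤1+j = ≤-trans (∸-monoʳ-≤ Z 1≤c) (∸-monoˡ-≤ 1 Z≤1+j)

  -- tails b Z: the number of partitions (of any size ≤ Z) with parts in [m, b].
  tails : ℕ → ℕ → ℕ
  tails b Z = tailsUpTo Z b Z

  tails-small : ∀ b Z → b < m → tails b Z ≡ 1
  tails-small b zero    _   = refl
  tails-small b (suc Z) b<m =
    cong (1 +_) (∑-zero b (λ c _ c≤b →
      when-no (nextPart? b (suc Z) c) (<⇒≱ (≤-trans (s≤s c≤b) b<m) ∘ proj₁ ∘ proj₁)))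

  -- Tails with parts ≤ b+1 either avoid b+1, or begin with a part b+1 followed by a tail below b+1.
  tails-step : ∀ b Z →
    tails (suc b) Z ≡ tails b Z + when (nextPart? (suc b) Z (suc b)) (tails (suc b) (Z ∸ suc b))
  tails-step b zero =
    sym (cong (1 +_) (when-no (nextPart? (suc b) 0 (suc b)) (<⇒≱ (s≤s z≤n) ∘ proj₂)))
  tails-step b (suc Z) = cong₂ (λ u v → 1 + (u + v))
    (∑-cong b (λ c _ c≤b → when-⇔ (nextPart? (suc b) (suc Z) c) (nextPart? b (suc Z) c)
      (λ { ((m≤c , _) , c≤Z) → (m≤c , c≤b) , c≤Z })
      (λ { ((m≤c , c≤b) , c≤Z) → (m≤c , m≤n⇒m≤1+n c≤b) , c≤Z })
      (λ _ → refl)))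
    (when-cong (nextPart? (suc b) (suc Z) (suc b))
      (λ _ → tailsUpTo-stable Z (suc Z ∸ suc b) (suc b) (suc Z ∸ suc b) (m∸n≤m Z b) ≤-refl))

module SecondPart (m : ℕ) (1≤m : 1 ≤ m) where
  open Tails m
  open +-*-Solver using (solve; _:+_; _:=_; con)

  -- b can be the second part of a partition of N counted by p t N m.
  Admissible : ℕ → ℕ → ℕ → Set
  Admissible t N b = m ≤ b × suc t * b ≤ N

  admissible? : (t N b : ℕ) → Dec (Admissible t N b)
  admissible? t N b = (m ≤? b) ×-dec (suc t * b ≤? N)

  secondTerm : ℕ → ℕ → ℕ → ℕ
  secondTerm t N b = when (admissible? t N b) (tails b (N ∸ suc t * b))

  -- Weight of the parts r after the largest part of a partition counted by p t N m.
  restWeight : ℕ → ℕ → List ℕ → ℕ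
  restWeight t N []      = when (m ≤? N) 1
  restWeight t N (b ∷ ν) = when (admissible? t N b ×-dec tailBelow? b (N ∸ suc t * b) ν) 1

  swap-ends : ∀ x y z → x + (y + z) ≡ z + (y + x)
  swap-ends = solve 3 (λ x y z → x :+ (y :+ z) := z :+ (y :+ x)) refl

  room : ∀ t N b ν → Admissible t N b → TailBelow b (N ∸ suc t * b) ν → t * b + (b + sum ν) ≤ N
  room t N b ν (_ , t+1b≤N) (_ , ν≤Z) =
    subst (_≤ N) (swap-ends (sum ν) b (t * b)) (m≤o∸n⇒m+n≤o (sum ν) t+1b≤N ν≤Z)

  counted-single : ∀ t N a → when (counted? t N m (a ∷ [])) 1 ≡ when (a ≟ N) (restWeight t N [])
  counted-single t N a = when-× (a ≟ N) (m ≤? N) (counted? t N m (a ∷ [])) split join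
    where
    split : Counted t N m (a ∷ []) → a ≡ N × m ≤ N
    split ((((_ , _) , a+0≡N) , (m≤a ∷ [])) , _) = a≡N , subst (m ≤_) a≡N m≤a
      where
      a≡N : a ≡ N
      a≡N = trans (sym (+-identityʳ a)) a+0≡N
    join : a ≡ N × m ≤ N → Counted t N m (a ∷ [])
    join (refl , m≤a) = ((([-] , (≤-trans 1≤m m≤a ∷ [])) , +-identityʳ a) , (m≤a ∷ [])) , tt

  counted-∷ : ∀ t N a b ν →
    when (counted? (suc t) N m (a ∷ b ∷ ν)) 1 ≡ when (a ≟ N ∸ (b + sum ν)) (restWeight (suc t) N (b ∷ ν))
  counted-∷ t N a b ν =
    when-× (a ≟ N ∸ X) (admissible? T N b ×-dec tailBelow? b Z ν) (counted? T N m (a ∷ b ∷ ν)) split join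
    where
    T : ℕ
    T = suc t
    X : ℕ
    X = b + sum ν
    Z : ℕ
    Z = N ∸ suc T * b
    split : Counted T N m (a ∷ b ∷ ν) → a ≡ N ∸ X × (Admissible T N b × TailBelow b Z ν)
    split ((((b≤a ∷ ordered , _) , a+X≡N) , (_ ∷ m≤b ∷ large)) , Tb≤a) =
      trans (sym (m+n∸n≡m a X)) (cong (_∸ X) a+X≡N) ,
      ((m≤b , m+n≤o⇒n≤o (sum ν) budget) , ((ordered , large) , m+n≤o⇒m≤o∸n (sum ν) budget))
      where
      budget : sum ν + suc T * b ≤ N
      budget = subst (_≤ N) (swap-ends (T * b) b (sum ν)) (subst (T * b + X ≤_) a+X≡N (+-monoˡ-≤ X Tb≤a))
    join : a ≡ N ∸ X × (Admissible T N b × TailBelow b Z ν) → Counted T N m (a ∷ b ∷ ν)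
    join (refl , (adm , tail@((ordered , large) , _))) =
      ((((b≤a ∷ ordered) , (1≤ (≤-trans m≤b b≤a) ∷ 1≤ m≤b ∷ All.map 1≤ large)) , m∸n+n≡m X≤N) ,
        (≤-trans m≤b b≤a ∷ m≤b ∷ large)) , Tb≤a
      where
      m≤b : m ≤ b
      m≤b = proj₁ adm
      Tb≤a : T * b ≤ N ∸ X
      Tb≤a = m+n≤o⇒m≤o∸n (T * b) (room T N b ν adm tail)
      X≤N : X ≤ N
      X≤N = m+n≤o⇒n≤o (T * b) (room T N b ν adm tail)
      b≤a : b ≤ N ∸ X
      b≤a = ≤-trans (m≤n*m b T) Tb≤a
      1≤ : ∀ {x} → m ≤ x → 1 ≤ x
      1≤ = ≤-trans 1≤m

  sum-largest : ∀ t N (r : List ℕ) →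
    ∑ N (λ a → when (counted? (suc t) N m (a ∷ r)) 1) ≡ restWeight (suc t) N r
  sum-largest t N [] =
    trans (∑-cong N (λ a _ _ → counted-single (suc t) N a))
          (∑-delta-when N N 1 (m ≤? N) (≤-trans 1≤m) ≤-refl)
  sum-largest t N (b ∷ ν) =
    trans (∑-cong N (λ a _ _ → counted-∷ t N a b ν))
          (∑-delta-when N (N ∸ (b + sum ν)) 1 (admissible? T N b ×-dec tailBelow? b Z ν) 1≤a (m∸n≤m N (b + sum ν)))
    where
    T : ℕ
    T = suc t
    Z : ℕ
    Z = N ∸ suc T * b
    1≤a : Admissible T N b × TailBelow b Z ν → 1 ≤ N ∸ (b + sum ν)
    1≤a (adm , tail) = ≤-trans (≤-trans 1≤m (proj₁ adm))
      (≤-trans (m≤n*m b T) (m+n≤o⇒m≤o∸n (T * b) (room T N b ν adm tail)))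

  ≤*m : ∀ k → k ≤ k * m
  ≤*m k = subst (_≤ k * m) (*-identityʳ k) (*-monoʳ-≤ k 1≤m)

  two≤ : ∀ t b → 1 ≤ b → 2 ≤ suc (suc t) * b
  two≤ t b 1≤b = *-mono-≤ {2} {suc (suc t)} {1} {b} (s≤s (s≤s z≤n)) 1≤b

  sum-rest : ∀ t K →
    candSum (suc K) K (restWeight (suc t) (suc K)) ≡ when (m ≤? suc K) 1 + ∑ (suc K) (secondTerm (suc t) (suc K))
  sum-rest t zero = trans (candSum-zero 1 (restWeight (suc t) 1)) (sym (trans
    (cong (when (m ≤? 1) 1 +_) (∑-zero 1 (λ b 1≤b _ →
      when-no (admissible? (suc t) 1 b) {tails b (1 ∸ suc (suc t) * b)} (<⇒≱ (two≤ t b 1≤b) ∘ proj₂))))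
    (+-identityʳ _)))
  sum-rest t (suc K) = trans (candSum-suc N K (restWeight T N)) (cong (when (m ≤? N) 1 +_) (∑-cong N second))
    where
    T : ℕ
    T = suc t
    N : ℕ
    N = suc (suc K)
    second : ∀ b → 1 ≤ b → b ≤ N → candSum N K (λ ν → restWeight T N (b ∷ ν)) ≡ secondTerm T N b
    second b 1≤b b≤N = begin
      candSum N K (λ ν → when (admissible? T N b ×-dec tailBelow? b Z ν) 1)
        ≡⟨ total-cong (λ ν → when-× (admissible? T N b) (tailBelow? b Z ν) (admissible? T N b ×-dec tailBelow? b Z ν)
                                     (λ x → x) (λ x → x)) (candidates N K) ⟩
      candSum N K (λ ν → when (admissible? T N b) (when (tailBelow? b Z ν) 1))
        ≡⟨ total-when (admissible? T N b) _ (candidates N K) ⟩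
      when (admissible? T N b) (candSum N K (λ ν → when (tailBelow? b Z ν) 1))
        ≡⟨ when-cong (admissible? T N b) (λ _ → count-tails K N b Z b≤N) ⟩
      when (admissible? T N b) (tailsUpTo K b Z)
        ≡⟨ when-cong (admissible? T N b)
             (λ _ → tailsUpTo-stable K Z b Z (∸-monoʳ-≤ N (two≤ t b 1≤b)) ≤-refl) ⟩
      secondTerm T N b ∎
      where
      open ≡-Reasoning
      Z : ℕ
      Z = N ∸ suc T * b

  p-decomposition : ∀ t N → 1 ≤ N → p (suc t) N m ≡ when (m ≤? N) 1 + ∑ N (secondTerm (suc t) N)
  p-decomposition t (suc K) _ = begin
    p T N m
      ≡⟨ count-filter (counted? T N m) (candidates N N) ⟩
    candSum N N counted
      ≡⟨ candSum-suc N K counted ⟩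
    counted [] + ∑ N (λ a → candSum N K (λ r → counted (a ∷ r)))
      ≡⟨ cong₂ _+_ (when-no (counted? T N m []) {1} (λ { ((((_ , _) , ()) , _) , _) }))
                   (sym (total-∑ N (λ a r → counted (a ∷ r)) (candidates N K))) ⟩
    candSum N K (λ r → ∑ N (λ a → counted (a ∷ r)))
      ≡⟨ total-cong (sum-largest t N) (candidates N K) ⟩
    candSum N K (restWeight T N)
      ≡⟨ sum-rest t K ⟩
    when (m ≤? N) 1 + ∑ N (secondTerm T N) ∎
    where
    open ≡-Reasoning
    T : ℕ
    T = suc t
    N : ℕ
    N = suc K
    counted : List ℕ → ℕ
    counted λs = when (counted? T N m λs) 1

  secondTerm-step : ∀ s n b → suc s * m ≤ n →
    secondTerm s n (suc b) ≡ secondTerm (suc s) n (suc b) + (secondTerm s (n ∸ suc s) b + when (suc b ≟ m) 1)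
  secondTerm-step s n b tm≤n with admissible? s n (suc b)
  ... | no ¬adm = sym (cong₂ _+_ B≡0 (cong₂ _+_ C≡0 E≡0))
    where
    B≡0 : secondTerm (suc s) n (suc b) ≡ 0
    B≡0 = when-no (admissible? (suc s) n (suc b)) (λ (m≤ , le) → ¬adm (m≤ , m+n≤o⇒n≤o (suc b) le))
    C≡0 : secondTerm s (n ∸ suc s) b ≡ 0
    C≡0 = when-no (admissible? s (n ∸ suc s) b) (λ (m≤b , le) → ¬adm (m≤n⇒m≤1+n m≤b , shift-up le))
      where
      t≤n : suc s ≤ n
      t≤n = ≤-trans (≤*m (suc s)) tm≤n
      shift-up : suc s * b ≤ n ∸ suc s → suc s * suc b ≤ n
      shift-up le = subst (_≤ n) (trans (+-comm (suc s * b) (suc s)) (sym (*-suc (suc s) b)))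
                          (m≤o∸n⇒m+n≤o (suc s * b) t≤n le)
    E≡0 : when (suc b ≟ m) 1 ≡ 0
    E≡0 = when-no (suc b ≟ m) (λ { refl → ¬adm (≤-refl , tm≤n) })
  ... | yes (m≤1+b , adm) = begin
    tails (suc b) Z
      ≡⟨ tails-step b Z ⟩
    tails b Z + when (nextPart? (suc b) Z (suc b)) (tails (suc b) (Z ∸ suc b))
      ≡⟨ cong₂ _+_ (avoiding (m ≤? b)) repeating ⟩
    (secondTerm s (n ∸ suc s) b + when (suc b ≟ m) 1) + secondTerm (suc s) n (suc b)
      ≡⟨ +-comm _ (secondTerm (suc s) n (suc b)) ⟩
    secondTerm (suc s) n (suc b) + (secondTerm s (n ∸ suc s) b + when (suc b ≟ m) 1) ∎
    where
    open ≡-Reasoning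
    t : ℕ
    t = suc s
    Z : ℕ
    Z = n ∸ t * suc b
    -- Tails containing a part b+1: the partition also has a part b+1 after its second part.
    repeating : when (nextPart? (suc b) Z (suc b)) (tails (suc b) (Z ∸ suc b)) ≡ secondTerm t n (suc b)
    repeating = when-⇔ (nextPart? (suc b) Z (suc b)) (admissible? t n (suc b))
      (λ ((m≤ , _) , 1+b≤Z) → m≤ , m≤o∸n⇒m+n≤o (suc b) adm 1+b≤Z)
      (λ (m≤ , le) → (m≤ , ≤-refl) , m+n≤o⇒m≤o∸n (suc b) le)
      (λ _ → cong (tails (suc b)) (trans (∸-+-assoc n (t * suc b) (suc b)) (cong (n ∸_) (+-comm (t * suc b) (suc b)))))
    -- Tails avoiding b+1 are tails below b: with second part b and size n − t, unless b < m.
    avoiding : Dec (m ≤ b) → tails b Z ≡ secondTerm s (n ∸ t) b + when (suc b ≟ m) 1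
    avoiding (yes m≤b) = begin
      tails b Z                              ≡⟨ cong (tails b) (sym budget) ⟩
      tails b ((n ∸ t) ∸ t * b)              ≡⟨ sym (when-yes (admissible? s (n ∸ t) b) (m≤b , adm′)) ⟩
      secondTerm s (n ∸ t) b                 ≡⟨ sym (+-identityʳ _) ⟩
      secondTerm s (n ∸ t) b + 0
        ≡⟨ cong (secondTerm s (n ∸ t) b +_) (sym (when-no (suc b ≟ m) (λ 1+b≡m → <⇒≱ (≤-reflexive 1+b≡m) m≤b))) ⟩
      secondTerm s (n ∸ t) b + when (suc b ≟ m) 1 ∎
      where
      budget : (n ∸ t) ∸ t * b ≡ Z
      budget = trans (∸-+-assoc n t (t * b)) (cong (n ∸_) (sym (*-suc t b)))
      adm′ : t * b ≤ n ∸ t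
      adm′ = m+n≤o⇒m≤o∸n (t * b) (subst (_≤ n) (trans (*-suc t b) (+-comm t (t * b))) adm)
    avoiding (no m≰b) = trans (tails-small b Z (≰⇒> m≰b)) (sym (cong₂ _+_
      (when-no (admissible? s (n ∸ t) b) (m≰b ∘ proj₁))
      (when-yes (suc b ≟ m) (≤-antisym (≰⇒> m≰b) m≤1+b))))

  ∑-secondTerm : ∀ s n → suc (suc s) * m ≤ n →
    ∑ n (secondTerm s n) ≡ ∑ n (secondTerm (suc s) n) + (∑ (n ∸ suc s) (secondTerm s (n ∸ suc s)) + 1)
  ∑-secondTerm s n t+1m≤n = begin
    ∑ n A                                      ≡⟨ ∑-cong n (λ { (suc b) _ _ → secondTerm-step s n b tm≤n }) ⟩
    ∑ n (λ a → B a + (C (a ∸ 1) + E a))        ≡⟨ ∑-+ n B _ ⟩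
    ∑ n B + ∑ n (λ a → C (a ∸ 1) + E a)        ≡⟨ cong (∑ n B +_) (∑-+ n (λ a → C (a ∸ 1)) E) ⟩
    ∑ n B + (∑ n (λ a → C (a ∸ 1)) + ∑ n E)
      ≡⟨ cong (∑ n B +_) (cong₂ _+_ shifted (∑-delta n m 1 1≤m m≤n)) ⟩
    ∑ n B + (∑ (n ∸ t) C + 1)                  ∎
    where
    open ≡-Reasoning
    t : ℕ
    t = suc s
    A : ℕ → ℕ
    A = secondTerm s n
    B : ℕ → ℕ
    B = secondTerm t n
    C : ℕ → ℕ
    C = secondTerm s (n ∸ t)
    E : ℕ → ℕ
    E a = when (a ≟ m) 1
    tm≤n : t * m ≤ n
    tm≤n = m+n≤o⇒n≤o m t+1m≤n
    m≤n : m ≤ n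
    m≤n = m+n≤o⇒m≤o m t+1m≤n
    -- C vanishes at 0 and beyond n − t, so the shifted sum is a sum up to n − t.
    shifted : ∑ n (λ a → C (a ∸ 1)) ≡ ∑ (n ∸ t) C
    shifted = trans (∑-shift n (when-no (admissible? s (n ∸ t) 0) (<⇒≱ 1≤m ∘ proj₁)))
      (∑-truncate (n ∸ t) (n ∸ 1)
        (λ c n∸t<c → when-no (admissible? s (n ∸ t) c) (λ (_ , le) → <⇒≱ n∸t<c (≤-trans (m≤n*m c t) le)))
        (∸-monoʳ-≤ n (s≤s (z≤n {s}))))

  p-recurrence : ∀ s n → suc (suc (suc s)) * m ≤ n →
    p (suc s) n m ≡ p (suc (suc s)) n m + p (suc s) (n ∸ suc (suc s)) m
  p-recurrence s n t+1m≤n = begin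
    p (suc s) n m                           ≡⟨ p-decomposition s n 1≤n ⟩
    I + ∑ n A                               ≡⟨ cong (I +_) (∑-secondTerm (suc s) n t+1m≤n) ⟩
    I + (∑ n B + (∑ (n ∸ t) C + 1))         ≡⟨ regroup I (∑ n B) (∑ (n ∸ t) C) ⟩
    (I + ∑ n B) + (1 + ∑ (n ∸ t) C)         ≡⟨ cong₂ _+_ (sym (p-decomposition (suc s) n 1≤n)) (sym smaller) ⟩
    p t n m + p (suc s) (n ∸ t) m           ∎
    where
    open ≡-Reasoning
    t : ℕ
    t = suc (suc s)
    A : ℕ → ℕ
    A = secondTerm (suc s) n
    B : ℕ → ℕ
    B = secondTerm t n
    C : ℕ → ℕ
    C = secondTerm (suc s) (n ∸ t)
    I : ℕ
    I = when (m ≤? n) 1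
    m≤n∸t : m ≤ n ∸ t
    m≤n∸t = m+n≤o⇒m≤o∸n m (≤-trans (+-monoʳ-≤ m (≤*m t)) t+1m≤n)
    1≤n : 1 ≤ n
    1≤n = ≤-trans 1≤m (m+n≤o⇒m≤o m t+1m≤n)
    smaller : p (suc s) (n ∸ t) m ≡ 1 + ∑ (n ∸ t) C
    smaller = trans (p-decomposition s (n ∸ t) (≤-trans 1≤m m≤n∸t))
                    (cong (_+ ∑ (n ∸ t) C) (when-yes (m ≤? n ∸ t) m≤n∸t))
    regroup : ∀ i b c → i + (b + (c + 1)) ≡ (i + b) + (1 + c)
    regroup = solve 3 (λ i b c → i :+ (b :+ (c :+ con 1)) := (i :+ b) :+ (con 1 :+ c)) refl

≤-quotient : ∀ m n k .{{_ : NonZero k}} → m ≤ n / k → k * m ≤ n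
≤-quotient m n k m≤n/k = subst (_≤ n) (*-comm m k) (≤-trans (*-monoˡ-≤ k m≤n/k) (m/n*n≤m n k))

theorem3 : (n m t : ℕ) → 1 ≤ m → 1 < t → t < n → m ≤ n / suc t →
    p t n m ≡ p (t ∸ 1) n m ∸ p (t ∸ 1) (n ∸ t) m
theorem3 n m t@(suc (suc s)) 1≤m (s≤s (s≤s _)) _ m≤n/t+1 = begin
  p t n m                                   ≡⟨ sym (m+n∸n≡m (p t n m) (p (suc s) (n ∸ t) m)) ⟩
  p t n m + p (suc s) (n ∸ t) m ∸ p (suc s) (n ∸ t) m
    ≡⟨ cong (_∸ p (suc s) (n ∸ t) m) (sym (SecondPart.p-recurrence m 1≤m s n (≤-quotient m n (suc t) m≤n/t+1))) ⟩
  p (suc s) n m ∸ p (suc s) (n ∸ t) m       ∎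
  where open ≡-Reasoning
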